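{- $\mathrm{1t1DPD}\nsubseteq 1\mathrm{P}$.
   Context: A one-way nondeterministic finite automaton (1nfa) is $M=(Q,\Sigma,\{\rhd,\lhd\},\delta,q_0,Q_{acc},Q_{rej})$: finite state set $Q$, input alphabet $\Sigma$, endmarkers $\rhd,\lhd\notin\Sigma$, disjoint sets $Q_{acc},Q_{rej}\subseteq Q$ ($Q_{halt}=Q_{acc}\cup Q_{rej}$), transition function $\delta:(Q-Q_{halt})\times(\Sigma\cup\{\rhd,\lhd\})\to\mathcal P(Q)$. On input $x$ it reads $\rhd x\lhd$ left to right, moving its head one cell right at every step (no $\lambda$-moves), halting on entering a halting state. $\#M(x)$, $\#\overline{M}(x)$ are the numbers of paths entering $Q_{acc}$, resp. $Q_{rej}$. A family $\{M_n\}$ of 1nfa's has polynomial size if $|Q_n|\le p(n)$ for a polynomial $p$. A one-way deterministic pushdown automaton (1dpda) is $M=(Q,\Sigma,\{\rhd,\lhd\},\Gamma,\delta,q_0,\bot,Q_{acc},Q_{rej})$ with stack alphabet $\Gamma$, bottom marker $\bot$, and $\delta:(Q-Q_{halt})\times(\Sigma\cup\{\rhd,\lhd,\lambda\})\times\Gamma\to\mathcal P(Q\times\Gamma^{\le e})$ ($\lambda$-moves allowed) with $|\delta(q,\sigma,a)\cup\delta(q,\lambda,a)|\le1$ for all $q,\sigma,a$; $e$ (push size) is the maximum length of a pushed string; it accepts (rejects) by entering $Q_{acc}$ ($Q_{rej}$). A family $\{M_n\}$ of 1dpda's has polynomial size if $|Q_n|\cdot|\Gamma_n^{\le e_n}|\le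 p(n)$ for a polynomial $p$. A turn is a change from a phase of increasing stack height to a phase of non-increasing stack height; a 1-turn 1dpda makes at most one turn on every computation. A family of promise problems over a fixed alphabet $\Sigma$ is $\mathcal L=\{(L_n^{(+)},L_n^{(-)})\}_{n\in\mathbb N}$ with disjoint $L_n^{(\pm)}\subseteq\Sigma^*$. $\mathrm{1t1DPD}$ is the class of families $\mathcal L$ for which a polynomial-size family of 1-turn 1dpda's $\{M_n\}$ exists with $M_n$ accepting all $x\in L_n^{(+)}$ and rejecting all $x\in L_n^{(-)}$. $1\mathrm{Gap}$ is the class of families of partial functions $\{(f_n,D_n)\}$ for which a polynomial-size family of 1nfa's satisfies $f_n(x)=\#M_n(x)-\#\overline{M}_n(x)$ for $x\in D_n$; $\mathcal L\in1\mathrm P$ iff some $\{(f_n,D_n)\}\in1\mathrm{Gap}$ has $L_n^{(+)}\cup L_n^{(-)}\subseteq D_n$, $f_n>0$ on $L_n^{(+)}$, $f_n\le0$ on $L_n^{(-)}$. -}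

module Defs where

open import Data.Nat using (ℕ; zero; suc; _+_; _*_; _^_; _≤_; _<_; _<?_; _≤?_)
open import Data.Bool using (Bool; true; false; if_then_else_; _∧_; _∨_)
open import Data.Fin using (Fin; zero; suc)
open import Data.List using (List; []; _∷_; _++_; length; map)
open import Data.Maybe using (Maybe; just; nothing)
open import Data.Product using (Σ; _×_; _,_; ∃)
open import Data.Sum using (_⊎_)
open import Data.Empty using (⊥)
open import Data.Integer as ℤ using (ℤ; +_)
open import Relation.Nullary using (¬_)
open import Relation.Nullary.Decidable using (⌊_⌋)
open import Relation.Binary.PropositionalEquality using (_≡_; _≢_)

data Sym (k : ℕ) : Set where
  ⊳ ⊲ : Sym k
  sym : Fin k → Sym k

tape : ∀ {k} → List (Fin k) → List (Sym k)
tape x = ⊳ ∷ map sym x ++ (⊲ ∷ [])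

sumFin : ∀ n → (Fin n → ℕ) → ℕ
sumFin zero    f = 0
sumFin (suc n) f = f zero + sumFin n (λ i → f (suc i))

-- polynomial boundedness: f n ≤ p(n) for some polynomial p
-- (every polynomial is bounded by one of the form c·n^d + c, and these are polynomials)
PolyBounded : (ℕ → ℕ) → Set
PolyBounded f = Σ ℕ λ c → Σ ℕ λ d → ∀ n → f n ≤ c * n ^ d + c

record PromiseFamily (k : ℕ) : Set₁ where
  field
    L⁺ L⁻ : ℕ → List (Fin k) → Set
    disjoint : ∀ n x → L⁺ n x → L⁻ n x → ⊥

-- 1nfa's.  States Q = Fin nQ; δ q σ q' = true iff q' ∈ δ(q,σ).
-- (δ on halting states is irrelevant: the machine halts there.)

record NFA (k : ℕ) : Set where
  field
    nQ  : ℕ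
    δ   : Fin nQ → Sym k → Fin nQ → Bool
    q₀  : Fin nQ
    acc rej : Fin nQ → Bool
    disjoint : ∀ q → acc q ≡ true → rej q ≡ false

  halting : Fin nQ → Bool
  halting q = acc q ∨ rej q

  paths : (Fin nQ → Bool) → Fin nQ → List (Sym k) → ℕ
  paths t q []      = if t q then 1 else 0
  paths t q (a ∷ w) =
    if t q then 1 else
    (if halting q then 0 else
     sumFin nQ (λ q' → if δ q a q' then paths t q' w else 0))

  #acc : List (Fin k) → ℕ
  #acc x = paths acc q₀ (tape x)

  #rej : List (Fin k) → ℕ
  #rej x = paths rej q₀ (tape x)

  gap : List (Fin k) → ℤ
  gap x = + #acc x ℤ.- + #rej x

-- 1Gap: families of partial functions (f_n, D_n)
In1Gap : ∀ {k} → (ℕ → List (Fin k) → ℤ) → (ℕ → List (Fin k) → Set) → Set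
In1Gap {k} f D = Σ (ℕ → NFA k) λ M →
  PolyBounded (λ n → NFA.nQ (M n)) ×
  (∀ n x → D n x → f n x ≡ NFA.gap (M n) x)

In1P : ∀ {k} → PromiseFamily k → Set₁
In1P {k} L = Σ (ℕ → List (Fin k) → ℤ) λ f → Σ (ℕ → List (Fin k) → Set) λ D →
  In1Gap f D ×
  (∀ n x → L⁺ n x ⊎ L⁻ n x → D n x) ×
  (∀ n x → L⁺ n x → ℤ.+0 ℤ.< f n x) ×
  (∀ n x → L⁻ n x → f n x ℤ.≤ ℤ.+0)
  where open PromiseFamily L

-- States Fin nQ, stack alphabet Γ = Fin nΓ (containing ⊥ = bot).
-- δ q (just σ) a / δ q nothing a  is δ(q,σ,a) / δ(q,λ,a), a set with ≤ 1 element
-- (nothing = ∅, just (p , w) = {(p,w)}); the move replaces the top symbol a by w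
-- (w listed top first).

-- |Γ^{≤e}| = Σ_{i ≤ e} |Γ|^i
powSum : ℕ → ℕ → ℕ
powSum g zero    = 1
powSum g (suc e) = powSum g e + g ^ suc e

record DPDA (k : ℕ) : Set where
  field
    nQ nΓ e : ℕ
    δ   : Fin nQ → Maybe (Sym k) → Fin nΓ → Maybe (Fin nQ × List (Fin nΓ))
    q₀  : Fin nQ
    bot : Fin nΓ
    acc rej : Fin nQ → Bool
    disjoint : ∀ q → acc q ≡ true → rej q ≡ false
    pushBound : ∀ q i a p w → δ q i a ≡ just (p , w) → length w ≤ e
    deterministic : ∀ q σ a → δ q nothing a ≢ nothing → δ q (just σ) a ≡ nothing

  halting : Fin nQ → Bool
  halting q = acc q ∨ rej q

  size : ℕ
  size = nQ * powSum nΓ e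

  -- configuration: state, remaining tape, stack (top first)
  Config : Set
  Config = Fin nQ × List (Sym k) × List (Fin nΓ)

  height : Config → ℕ
  height (_ , _ , st) = length st

  data Step : Config → Config → Set where
    λ-step : ∀ {q inp a st p w} → halting q ≡ false →
             δ q nothing a ≡ just (p , w) →
             Step (q , inp , a ∷ st) (p , inp , w ++ st)
    read   : ∀ {q σ inp a st p w} → halting q ≡ false →
             δ q (just σ) a ≡ just (p , w) →
             Step (q , σ ∷ inp , a ∷ st) (p , inp , w ++ st)

  data Steps : Config → Config → List ℕ → Set where
    done : ∀ {c} → Steps c c (height c ∷ [])
    next : ∀ {c c' c'' hs} → Step c c' → Steps c' c'' hs → Steps c c'' (height c ∷ hs)

  init : List (Fin k) → Config
  init x = q₀ , tape x , bot ∷ []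

  Accepts : List (Fin k) → Set
  Accepts x = Σ Config λ c → Σ (List ℕ) λ hs →
    Steps (init x) c hs × acc (Data.Product.proj₁ c) ≡ true

  Rejects : List (Fin k) → Set
  Rejects x = Σ Config λ c → Σ (List ℕ) λ hs →
    Steps (init x) c hs × rej (Data.Product.proj₁ c) ≡ true

turns : List ℕ → ℕ
turns (a ∷ b ∷ c ∷ r) =
  (if ⌊ a <? b ⌋ ∧ ⌊ c ≤? b ⌋ then 1 else 0) + turns (b ∷ c ∷ r)
turns _ = 0

OneTurn : ∀ {k} → DPDA k → Set
OneTurn M = ∀ x c hs → Steps (init x) c hs → turns hs ≤ 1
  where open DPDA M

In1t1DPD : ∀ {k} → PromiseFamily k → Set
In1t1DPD {k} L = Σ (ℕ → DPDA k) λ M →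
  PolyBounded (λ n → DPDA.size (M n)) ×
  (∀ n → OneTurn (M n)) ×
  (∀ n x → L⁺ n x → DPDA.Accepts (M n) x) ×
  (∀ n x → L⁻ n x → DPDA.Rejects (M n) x)
  where open PromiseFamily L

module Submission where

-- The gap of a 1nfa with state set Q is bilinear in a split of its tape: gap(⊳ w s ⊲) = u(w) · v(s)
-- in ℤ^(1+|Q|), where u(w) holds the signed number of paths halting inside w and the number of
-- paths in each state after w, and v(s) the gaps from each state on s.  On input 2^i β, with β a
-- bit string, the promise problem asks for the bit β_i; a one-turn 1dpda answers it by pushing a
-- mark per 2 and popping one per bit.  The 2+|Q| vectors u(⊳ 2^i) are linearly dependent over ℤ,
-- say Σ c_i u(⊳ 2^i) = 0 with some c_i > 0.  Put β_i = [c_i > 0].  A gap of the required sign on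
-- every 2^i β would make each term of Σ c_i gap(2^i β) nonnegative and one of them positive,
-- whereas the sum is (Σ c_i u(⊳ 2^i)) · v(β ⊲) = 0.

open import Defs renaming (sym to letter)
open import Data.Nat using (ℕ)
open import Data.Product using (Σ; _×_; _,_)
open import Relation.Nullary using (¬_)

module IntegerVectors where

  open import Data.Nat as ℕ using (zero; suc; s≤s; z≤n)
  import Data.Nat.Properties as ℕ
  open import Data.Fin using (Fin; zero; suc; punchIn)
  open import Data.Fin.Properties using (all?; ¬∀⟶∃¬)
  open import Data.Integer as ℤ
    using (ℤ; +0; +[1+_]; -[1+_]; 0ℤ; 1ℤ; -1ℤ; _+_; _*_; -_; _-_; _<_; _≤_; +<+; +≤+; _≟_; _<?_)
  import Data.Integer.Properties as ℤ
  open import Data.Integer.Tactic.RingSolver using (solve-∀)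
  open import Data.Vec.Functional using (Vector; tail; insertAt)
  open import Data.Vec.Functional.Properties using (insertAt-lookup; insertAt-punchIn)
  open import Data.Bool using (Bool; true; false)
  open import Data.Product using (∃-syntax; proj₂)
  open import Data.Sum using (inj₁; inj₂)
  open import Function using (_∘_)
  open import Relation.Nullary using (yes; no; contradiction)
  open import Relation.Nullary.Decidable using (⌊_⌋)
  open import Relation.Binary.PropositionalEquality
  open import Algebra.Properties.Semiring.Sum ℤ.+-*-semiring public
    using (sum; sum-cong-≗)
  open import Algebra.Properties.Semiring.Sum ℤ.+-*-semiring
    using (sum-replicate-zero; sum-remove; ∑-distrib-+; ∑-comm; *-distribˡ-sum; *-distribʳ-sum)

  infix 7 _·_

  _·_ : ∀ {n} → Vector ℤ n → Vector ℤ n → ℤ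
  u · v = sum (λ i → u i * v i)

  combination : ∀ {m n} → Vector ℤ m → (Fin m → Vector ℤ n) → Vector ℤ n
  combination c u k = c · (λ j → u j k)

  ·-zeroˡ : ∀ {n} {c : Vector ℤ n} v → (∀ i → c i ≡ 0ℤ) → c · v ≡ 0ℤ
  ·-zeroˡ {n} v c≡0 =
    trans (sum-cong-≗ (λ i → trans (cong (_* v i) (c≡0 i)) (ℤ.*-zeroˡ (v i)))) (sum-replicate-zero n)

  ·-zeroʳ : ∀ {n} c {v : Vector ℤ n} → (∀ i → v i ≡ 0ℤ) → c · v ≡ 0ℤ
  ·-zeroʳ {n} c v≡0 =
    trans (sum-cong-≗ (λ i → trans (cong (c i *_) (v≡0 i)) (ℤ.*-zeroʳ (c i)))) (sum-replicate-zero n)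

  ·-congʳ : ∀ {n} c {v w : Vector ℤ n} → (∀ i → v i ≡ w i) → c · v ≡ c · w
  ·-congʳ c v≡w = sum-cong-≗ (λ i → cong (c i *_) (v≡w i))

  sum-neg : ∀ {n} (v : Vector ℤ n) → sum (λ i → - v i) ≡ - sum v
  sum-neg v = begin
    sum (λ i → - v i)        ≡⟨ sum-cong-≗ (λ i → sym (ℤ.-1*i≡-i (v i))) ⟩
    sum (λ i → -1ℤ * v i)    ≡⟨ sym (*-distribˡ-sum -1ℤ v) ⟩
    -1ℤ * sum v              ≡⟨ ℤ.-1*i≡-i _ ⟩
    - sum v                  ∎
    where open ≡-Reasoning

  sum-minus : ∀ {n} (v w : Vector ℤ n) → sum v - sum w ≡ sum (λ i → v i - w i)
  sum-minus v w = sym (trans (∑-distrib-+ v (λ i → - w i)) (cong (_+_ (sum v)) (sum-neg w)))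

  ·-negˡ : ∀ {n} (c v : Vector ℤ n) → (λ i → - c i) · v ≡ - (c · v)
  ·-negˡ c v = trans (sum-cong-≗ (λ i → sym (ℤ.neg-distribˡ-* (c i) (v i)))) (sum-neg (λ i → c i * v i))

  ·-distribˡ-+ : ∀ {n} (c x y : Vector ℤ n) → c · (λ i → x i + y i) ≡ c · x + c · y
  ·-distribˡ-+ c x y =
    trans (sum-cong-≗ (λ i → ℤ.*-distribˡ-+ (c i) (x i) (y i)))
          (∑-distrib-+ (λ i → c i * x i) (λ i → c i * y i))

  unit : ∀ {n} → Fin n → Vector ℤ n
  unit zero    zero    = 1ℤ
  unit zero    (suc _) = 0ℤ
  unit (suc i) zero    = 0ℤ
  unit (suc i) (suc j) = unit i j

  unit-· : ∀ {n} (i : Fin n) v → unit i · v ≡ v i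
  unit-· zero    v =
    trans (cong₂ _+_ (ℤ.*-identityˡ (v zero)) (·-zeroˡ (tail v) (λ _ → refl))) (ℤ.+-identityʳ (v zero))
  unit-· (suc i) v = trans (ℤ.+-identityˡ _) (unit-· i (tail v))

  ·-combination : ∀ {m n} (c : Vector ℤ m) (u : Fin m → Vector ℤ n) v →
                  c · (λ j → u j · v) ≡ combination c u · v
  ·-combination c u v = begin
    c · (λ j → u j · v)
      ≡⟨ sum-cong-≗ (λ j → *-distribˡ-sum (c j) (λ k → u j k * v k)) ⟩
    sum (λ j → sum (λ k → c j * (u j k * v k)))
      ≡⟨ ∑-comm (λ j k → c j * (u j k * v k)) ⟩
    sum (λ k → sum (λ j → c j * (u j k * v k)))
      ≡⟨ sum-cong-≗ (λ k → sum-cong-≗ (λ j → sym (ℤ.*-assoc (c j) (u j k) (v k)))) ⟩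
    sum (λ k → sum (λ j → c j * u j k * v k))
      ≡⟨ sum-cong-≗ (λ k → sym (*-distribʳ-sum (v k) (λ j → c j * u j k))) ⟩
    combination c u · v ∎
    where open ≡-Reasoning

  Dependence : ∀ {m n} → (Fin m → Vector ℤ n) → Vector ℤ m → Set
  Dependence u c = (∃[ j ] c j ≢ 0ℤ) × (∀ k → combination c u k ≡ 0ℤ)

  -- One step of Gaussian elimination: every other vector is scaled by the pivot and has its first
  -- coordinate cleared against u p.
  module Pivot {m n} (u : Fin (suc m) → Vector ℤ (suc n)) (p : Fin (suc m)) where

    pivot : ℤ
    pivot = u p zero

    reduced : Fin m → Vector ℤ (suc n)
    reduced i k = pivot * u (punchIn p i) k - u (punchIn p i) zero * u p k

    reduced-zero : ∀ i → reduced i zero ≡ 0ℤ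
    reduced-zero i = lemma pivot (u (punchIn p i) zero)
      where
      lemma : ∀ a b → a * b - b * a ≡ 0ℤ
      lemma = solve-∀

    lift : Vector ℤ m → Vector ℤ (suc m)
    lift c = insertAt (λ i → c i * pivot) p (- combination c (u ∘ punchIn p) zero)

    combination-lift : ∀ c k → combination (lift c) u k ≡ combination c reduced k
    combination-lift c k = begin
      combination (lift c) u k
        ≡⟨ sum-remove {i = p} (λ j → lift c j * u j k) ⟩
      lift c p * u p k + sum (λ i → lift c (punchIn p i) * u (punchIn p i) k)
        ≡⟨ cong₂ _+_ (cong (_* u p k) (insertAt-lookup _ p _)) (sum-cong-≗ lifted) ⟩
      - S * u p k + sum (λ i → c i * reduced i k + c i * a i * u p k)
        ≡⟨ cong (_+_ (- S * u p k)) (∑-distrib-+ (λ i → c i * reduced i k) (λ i → c i * a i * u p k)) ⟩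
      - S * u p k + (combination c reduced k + sum (λ i → c i * a i * u p k))
        ≡⟨ cong (λ t → - S * u p k + (combination c reduced k + t))
                (*-distribʳ-sum (u p k) (λ i → c i * a i)) ⟨
      - S * u p k + (combination c reduced k + S * u p k)
        ≡⟨ cancel S (u p k) _ ⟩
      combination c reduced k ∎
      where
      open ≡-Reasoning
      a : Vector ℤ m
      a i = u (punchIn p i) zero
      S = c · a
      split : ∀ c a x b y → c * a * x ≡ c * (a * x - b * y) + c * b * y
      split = solve-∀
      cancel : ∀ s y r → - s * y + (r + s * y) ≡ r
      cancel = solve-∀
      lifted : ∀ i → lift c (punchIn p i) * u (punchIn p i) k ≡ c i * reduced i k + c i * a i * u p k
      lifted i = trans (cong (_* u (punchIn p i) k) (insertAt-punchIn _ p _ i))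
                       (split (c i) pivot (u (punchIn p i) k) (a i) (u p k))

    lift-nonzero : pivot ≢ 0ℤ → ∀ c i → c i ≢ 0ℤ → lift c (punchIn p i) ≢ 0ℤ
    lift-nonzero pivot≢0 c i ci≢0 lift≡0
      with ℤ.i*j≡0⇒i≡0∨j≡0 (c i) (trans (sym (insertAt-punchIn _ p _ i)) lift≡0)
    ... | inj₁ ci≡0     = ci≢0 ci≡0
    ... | inj₂ pivot≡0  = pivot≢0 pivot≡0

    lift-dependence : pivot ≢ 0ℤ → ∀ {c} → Dependence (tail ∘ reduced) c → Dependence u (lift c)
    lift-dependence pivot≢0 {c} ((i , ci≢0) , vanishes) =
      (punchIn p i , lift-nonzero pivot≢0 c i ci≢0) , λ k → trans (combination-lift c k) (reduced-vanishes k)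
      where
      reduced-vanishes : ∀ k → combination c reduced k ≡ 0ℤ
      reduced-vanishes zero    = ·-zeroʳ c reduced-zero
      reduced-vanishes (suc k) = vanishes k

  zero-coordinate-dependence : ∀ {m n} {u : Fin m → Vector ℤ (suc n)} {c} →
    (∀ j → u j zero ≡ 0ℤ) → Dependence (tail ∘ u) c → Dependence u c
  zero-coordinate-dependence {c = c} u≡0 (nonzero , vanishes) = nonzero , λ
    { zero    → ·-zeroʳ c u≡0
    ; (suc k) → vanishes k }

  linear-dependence : ∀ {m n} → n ℕ.< m → (u : Fin m → Vector ℤ n) → ∃[ c ] Dependence u c
  linear-dependence {suc m} {zero} _ u = unit zero , (zero , λ ()) , λ ()
  linear-dependence {suc m} {suc n} (s≤s n<m) u with all? (λ j → u j zero ≟ 0ℤ)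
  ... | yes u≡0 =
    let c , dependence = linear-dependence (ℕ.m<n⇒m<1+n n<m) (tail ∘ u)
    in c , zero-coordinate-dependence {u = u} u≡0 dependence
  ... | no u≢0 =
    let p , pivot≢0 = ¬∀⟶∃¬ _ _ (λ j → u j zero ≟ 0ℤ) u≢0
        c , dependence = linear-dependence n<m (tail ∘ Pivot.reduced u p)
    in Pivot.lift u p c , Pivot.lift-dependence u p pivot≢0 dependence

  positive-dependence : ∀ {m n} {u : Fin m → Vector ℤ n} {c} → Dependence u c →
    ∃[ c ] (∃[ j ] 0ℤ < c j) × (∀ k → combination c u k ≡ 0ℤ)
  positive-dependence {u = u} {c} ((j , cj≢0) , vanishes) with 0ℤ <? c j
  ... | yes cj>0 = c , (j , cj>0) , vanishes
  ... | no cj≯0  = (-_ ∘ c) , (j , ℤ.neg-mono-< (ℤ.≤∧≢⇒< (ℤ.≮⇒≥ cj≯0) cj≢0)) ,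
                   λ k → trans (·-negˡ c (λ j → u j k)) (cong -_ (vanishes k))

  Classifies : Bool → ℤ → Set
  Classifies true  z = 0ℤ < z
  Classifies false z = z ≤ 0ℤ

  pos*pos>0 : ∀ {i j} → 0ℤ < i → 0ℤ < j → 0ℤ < i * j
  pos*pos>0 {+[1+ _ ]} {+[1+ _ ]} _ _ = +<+ (s≤s z≤n)
  pos*pos>0 {+0}       (+<+ ())
  pos*pos>0 {+[1+ _ ]} {+0} _ (+<+ ())

  nonPos*nonPos≥0 : ∀ {i j} → i ≤ 0ℤ → j ≤ 0ℤ → 0ℤ ≤ i * j
  nonPos*nonPos≥0 {+0}                   _ _ = +≤+ z≤n
  nonPos*nonPos≥0 { -[1+ i ]} {+0}        _ _ = ℤ.≤-reflexive (sym (ℤ.*-zeroʳ -[1+ i ]))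
  nonPos*nonPos≥0 { -[1+ _ ]} { -[1+ _ ]}  _ _ = +≤+ z≤n
  nonPos*nonPos≥0 {+[1+ _ ]} (+≤+ ())
  nonPos*nonPos≥0 { -[1+ _ ]} {+[1+ _ ]} _ (+≤+ ())

  sign-agreement : ∀ c {z} → Classifies ⌊ 0ℤ <? c ⌋ z → 0ℤ ≤ c * z
  sign-agreement c classified with 0ℤ <? c
  ... | yes c>0 = ℤ.<⇒≤ (pos*pos>0 c>0 classified)
  ... | no c≯0  = nonPos*nonPos≥0 (ℤ.≮⇒≥ c≯0) classified

  strict-sign-agreement : ∀ {c z} → 0ℤ < c → Classifies ⌊ 0ℤ <? c ⌋ z → 0ℤ < c * z
  strict-sign-agreement {c} c>0 classified with 0ℤ <? c
  ... | yes _   = pos*pos>0 c>0 classified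
  ... | no c≯0  = contradiction c>0 c≯0

  sum-nonneg : ∀ {n} (t : Vector ℤ n) → (∀ i → 0ℤ ≤ t i) → 0ℤ ≤ sum t
  sum-nonneg {zero}  t _   = ℤ.≤-refl
  sum-nonneg {suc n} t t≥0 = ℤ.+-mono-≤ (t≥0 zero) (sum-nonneg (tail t) (t≥0 ∘ suc))

  sum-pos : ∀ {n} (t : Vector ℤ n) i → (∀ i → 0ℤ ≤ t i) → 0ℤ < t i → 0ℤ < sum t
  sum-pos {suc n} t i t≥0 ti>0 =
    subst (0ℤ <_) (sym (sum-remove {i = i} t)) (ℤ.+-mono-<-≤ ti>0 (sum-nonneg _ (t≥0 ∘ punchIn i)))

  no-shattering : ∀ {m n} → n ℕ.< m → (u : Fin m → Vector ℤ n) →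
                  ∃[ b ] ∀ v → ¬ (∀ j → Classifies (b j) (u j · v))
  no-shattering n<m u with positive-dependence (proj₂ (linear-dependence n<m u))
  ... | c , (j , cj>0) , vanishes = (λ j → ⌊ 0ℤ <? c j ⌋) , λ v classified →
    ℤ.<-irrefl
      (sym (trans (·-combination c u v) (·-zeroˡ v vanishes)))
      (sum-pos _ j (λ i → sign-agreement (c i) (classified i)) (strict-sign-agreement cj>0 (classified j)))

module GapFactorisation where

  open IntegerVectors
  open import Data.Nat using (zero; suc)
  open import Data.Fin using (Fin; zero; suc)
  open import Data.Integer as ℤ using (ℤ; +_; 0ℤ; 1ℤ; -1ℤ; _+_; _*_; _-_)
  import Data.Integer.Properties as ℤ
  open import Data.Vec.Functional using (Vector)
  open import Data.Bool using (Bool; true; false; if_then_else_)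
  open import Data.List using (List; []; _∷_; _++_)
  open import Function using (_∘_)
  open import Relation.Nullary using (contradiction)
  open import Relation.Binary.PropositionalEquality

  module Factorisation {S : Set} {n} (out : Vector ℤ n) (A : S → Fin n → Vector ℤ n)
    (G : List S → Vector ℤ n) (G-∷ : ∀ a v q → G (a ∷ v) q ≡ out q + A a q · G v) where

    emitted : List S → Vector ℤ n
    emitted []      q = 0ℤ
    emitted (a ∷ w) q = out q + A a q · emitted w

    transfer : List S → Fin n → Vector ℤ n
    transfer []      = unit
    transfer (a ∷ w) q = combination (A a q) (transfer w)

    G-++ : ∀ w s q → G (w ++ s) q ≡ emitted w q + transfer w q · G s
    G-++ []      s q = sym (trans (ℤ.+-identityˡ _) (unit-· q (G s)))
    G-++ (a ∷ w) s q = begin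
      G (a ∷ w ++ s) q
        ≡⟨ G-∷ a (w ++ s) q ⟩
      out q + A a q · G (w ++ s)
        ≡⟨ cong (_+_ (out q)) (·-congʳ (A a q) (G-++ w s)) ⟩
      out q + A a q · (λ r → emitted w r + transfer w r · G s)
        ≡⟨ cong (_+_ (out q)) (·-distribˡ-+ (A a q) (emitted w) (λ r → transfer w r · G s)) ⟩
      out q + (A a q · emitted w + A a q · (λ r → transfer w r · G s))
        ≡⟨ cong (λ x → out q + (A a q · emitted w + x)) (·-combination (A a q) (transfer w) (G s)) ⟩
      out q + (A a q · emitted w + transfer (a ∷ w) q · G s)
        ≡⟨ sym (ℤ.+-assoc (out q) _ _) ⟩
      emitted (a ∷ w) q + transfer (a ∷ w) q · G s ∎
      where open ≡-Reasoning

  indicator : Bool → ℤ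
  indicator b = if b then 1ℤ else 0ℤ

  pos-sumFin : ∀ n (f : Fin n → ℕ) → + sumFin n f ≡ sum (λ i → + f i)
  pos-sumFin zero    f = refl
  pos-sumFin (suc n) f = trans (ℤ.pos-+ (f zero) _) (cong (_+_ (+ f zero)) (pos-sumFin n (λ i → f (suc i))))

  pos-if-minus : ∀ b x y → + (if b then x else 0) - + (if b then y else 0) ≡ indicator b * (+ x - + y)
  pos-if-minus true  x y = sym (ℤ.*-identityˡ _)
  pos-if-minus false x y = refl

  module _ {k} (N : NFA k) where
    open NFA N

    gapVector : List (Sym k) → Vector ℤ nQ
    gapVector w q = + paths acc q w - + paths rej q w

    verdict : Vector ℤ nQ
    verdict q = if acc q then 1ℤ else if rej q then -1ℤ else 0ℤ

    successors : Sym k → Fin nQ → Vector ℤ nQ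
    successors a q q′ = if halting q then 0ℤ else indicator (δ q a q′)

    gapVector-∷ : ∀ a v q → gapVector (a ∷ v) q ≡ verdict q + successors a q · gapVector v
    gapVector-∷ a v q with acc q in acc≡ | rej q in rej≡
    ... | true  | true  = contradiction (trans (sym rej≡) (disjoint q acc≡)) λ ()
    ... | true  | false = sym (cong (_+_ 1ℤ) (·-zeroˡ (gapVector v) (λ _ → refl)))
    ... | false | true  = sym (cong (_+_ -1ℤ) (·-zeroˡ (gapVector v) (λ _ → refl)))
    ... | false | false = begin
      + sumFin nQ (via acc) - + sumFin nQ (via rej)
        ≡⟨ cong₂ _-_ (pos-sumFin nQ (via acc)) (pos-sumFin nQ (via rej)) ⟩
      sum (+_ ∘ via acc) - sum (+_ ∘ via rej)
        ≡⟨ sum-minus (+_ ∘ via acc) (+_ ∘ via rej) ⟩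
      sum (λ q′ → + via acc q′ - + via rej q′)
        ≡⟨ sum-cong-≗ (λ q′ → pos-if-minus (δ q a q′) _ _) ⟩
      sum (λ q′ → indicator (δ q a q′) * gapVector v q′)
        ≡⟨ ℤ.+-identityˡ _ ⟨
      0ℤ + sum (λ q′ → indicator (δ q a q′) * gapVector v q′) ∎
      where
      open ≡-Reasoning
      via : (Fin nQ → Bool) → Fin nQ → ℕ
      via t q′ = if δ q a q′ then paths t q′ v else 0

    open Factorisation verdict successors gapVector gapVector-∷

    prefixVector : List (Sym k) → Vector ℤ (suc nQ)
    prefixVector w zero    = emitted w q₀
    prefixVector w (suc q) = transfer w q₀ q

    suffixVector : List (Sym k) → Vector ℤ (suc nQ)
    suffixVector s zero    = 1ℤ
    suffixVector s (suc q) = gapVector s q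

    gap-bilinear : ∀ w s → gapVector (w ++ s) q₀ ≡ prefixVector w · suffixVector s
    gap-bilinear w s =
      trans (G-++ w s q₀) (cong (_+ transfer w q₀ · gapVector s) (sym (ℤ.*-identityʳ (emitted w q₀))))

module TurnCounting where

  open import Data.Nat as ℕ using (_<_; _≤_; _≥_; _<?_; _≤?_; z≤n)
  import Data.Nat.Properties as ℕ
  open import Data.Bool using (true; false)
  open import Data.Bool.Properties using (∧-zeroʳ)
  open import Data.List using (List; []; _∷_)
  open import Data.List.Relation.Unary.Linked using (Linked; []; [-]; _∷_)
  open import Relation.Nullary using (Dec)
  open import Relation.Nullary.Decidable using (⌊_⌋; isYes≗does; dec-true; dec-false)
  open import Relation.Binary.PropositionalEquality

  ⌊⌋-true : ∀ {A : Set} (a? : Dec A) → A → ⌊ a? ⌋ ≡ true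
  ⌊⌋-true a? a = trans (isYes≗does a?) (dec-true a? a)

  ⌊⌋-false : ∀ {A : Set} (a? : Dec A) → ¬ A → ⌊ a? ⌋ ≡ false
  ⌊⌋-false a? ¬a = trans (isYes≗does a?) (dec-false a? ¬a)

  turns-≥ : ∀ {a b} hs → b ≤ a → turns (a ∷ b ∷ hs) ≡ turns (b ∷ hs)
  turns-≥         []      _   = refl
  turns-≥ {a} {b} (_ ∷ _) b≤a rewrite ⌊⌋-false (a <? b) (ℕ.≤⇒≯ b≤a) = refl

  turns-antitone : ∀ {hs} → Linked _≥_ hs → turns hs ≡ 0
  turns-antitone []                         = refl
  turns-antitone [-]                        = refl
  turns-antitone {_ ∷ _ ∷ hs} (b≤a ∷ rest) = trans (turns-≥ hs b≤a) (turns-antitone rest)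

  turns-< : ∀ {x y z} hs → y < z → turns (x ∷ y ∷ z ∷ hs) ≡ turns (y ∷ z ∷ hs)
  turns-< {x} {y} {z} _ y<z rewrite ⌊⌋-false (z ≤? y) (ℕ.<⇒≱ y<z) | ∧-zeroʳ ⌊ x <? y ⌋ = refl

  data Unimodal : List ℕ → Set where
    descending : ∀ {hs} → Linked _≥_ hs → Unimodal hs
    ascending  : ∀ {x y hs} → x < y → Unimodal (y ∷ hs) → Unimodal (x ∷ y ∷ hs)

  turns-unimodal : ∀ {hs} → Unimodal hs → turns hs ≤ 1
  turns-unimodal (descending down) = subst (_≤ 1) (sym (turns-antitone down)) z≤n
  turns-unimodal (ascending _ (descending [-])) = z≤n
  turns-unimodal (ascending {x} {y} {z ∷ _} x<y (descending (z≤y ∷ down)))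
    rewrite ⌊⌋-true (x <? y) x<y | ⌊⌋-true (z ≤? y) z≤y | turns-antitone (z≤y ∷ down) = ℕ.≤-refl
  turns-unimodal (ascending {hs = z ∷ hs} _ up@(ascending y<z _)) =
    subst (_≤ 1) (sym (turns-< hs y<z)) (turns-unimodal up)

module Reachability {k} (M : DPDA k) where

  open DPDA M
  open import Data.Bool using (true)
  open import Data.Fin using (Fin)
  open import Data.List using (List)
  open import Data.Product using (proj₁)
  open import Relation.Binary.PropositionalEquality using (_≡_; refl)

  Reaches : Config → Fin nQ → Set
  Reaches c q = Σ Config λ c′ → Σ (List ℕ) λ hs → Steps c c′ hs × proj₁ c′ ≡ q

  here : ∀ {c} → Reaches c (proj₁ c)
  here = _ , _ , done , refl

  infixr 5 _◅_
  _◅_ : ∀ {c c′ q} → Step c c′ → Reaches c′ q → Reaches c q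
  step ◅ (c″ , _ , steps , c″≡q) = c″ , _ , next step steps , c″≡q

  accepts : ∀ {x q} → Reaches (init x) q → acc q ≡ true → Accepts x
  accepts (c , hs , steps , refl) accepting = c , hs , steps , accepting

  rejects : ∀ {x q} → Reaches (init x) q → rej q ≡ true → Rejects x
  rejects (c , hs , steps , refl) rejecting = c , hs , steps , rejecting

module QueryLanguage where

  open import Data.Nat as ℕ using (zero; suc; _+_)
  import Data.Nat.Properties as ℕ
  open import Data.Bool using (Bool; true; false)
  open import Data.Fin using (Fin; zero; suc; toℕ)
  open import Data.List using (List; []; _∷_; _++_; map; replicate)
  open import Data.Maybe using (Maybe; just; nothing)
  open import Data.Vec.Functional using (toList)
  open import Function using (_∘_; case_of_)
  open import Relation.Binary.PropositionalEquality

  pattern two = suc (suc zero)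

  bit : Bool → Fin 3
  bit false = zero
  bit true  = suc zero

  bitAt : ℕ → List (Fin 3) → Maybe Bool
  bitAt _       []              = nothing
  bitAt _       (two ∷ _)       = nothing
  bitAt zero    (zero ∷ _)      = just false
  bitAt zero    (suc zero ∷ _)  = just true
  bitAt (suc i) (zero ∷ x)      = bitAt i x
  bitAt (suc i) (suc zero ∷ x)  = bitAt i x

  -- query 0 (2^i β) is the bit β_i of the bit string β, counting from 0.
  query : ℕ → List (Fin 3) → Maybe Bool
  query i (two ∷ x) = query (suc i) x
  query i x         = bitAt i x

  Query : PromiseFamily 3
  Query = record
    { L⁺       = λ _ x → query 0 x ≡ just true
    ; L⁻       = λ _ x → query 0 x ≡ just false
    ; disjoint = λ _ _ accepted rejected → case trans (sym accepted) rejected of λ () }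

  query-twos : ∀ j i y → query i (replicate j two ++ y) ≡ query (j + i) y
  query-twos zero    i y = refl
  query-twos (suc j) i y = trans (query-twos j (suc i) y) (cong (λ n → query n y) (ℕ.+-suc j i))

  query-bit : ∀ i b y → query i (bit b ∷ y) ≡ bitAt i (bit b ∷ y)
  query-bit i false y = refl
  query-bit i true  y = refl

  bitAt-bit : ∀ i b y → bitAt (suc i) (bit b ∷ y) ≡ bitAt i y
  bitAt-bit i false y = refl
  bitAt-bit i true  y = refl

  bitAt-head : ∀ b y → bitAt zero (bit b ∷ y) ≡ just b
  bitAt-head false y = refl
  bitAt-head true  y = refl

  bitAt-bits : ∀ {m} (b : Fin m → Bool) j → bitAt (toℕ j) (map bit (toList b)) ≡ just (b j)
  bitAt-bits b zero    = bitAt-head (b zero) _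
  bitAt-bits b (suc j) = trans (bitAt-bit (toℕ j) (b zero) _) (bitAt-bits (b ∘ suc) j)

  word : ∀ {m} → (Fin m → Bool) → ℕ → List (Fin 3)
  word b i = replicate i two ++ map bit (toList b)

  query-word : ∀ {m} (b : Fin (suc m) → Bool) j → query 0 (word b (toℕ j)) ≡ just (b j)
  query-word b j = begin
    query 0 (word b (toℕ j))                ≡⟨ query-twos (toℕ j) 0 bits ⟩
    query (toℕ j + 0) bits                  ≡⟨ cong (λ i → query i bits) (ℕ.+-identityʳ (toℕ j)) ⟩
    query (toℕ j) bits                      ≡⟨ query-bit (toℕ j) (b zero) _ ⟩
    bitAt (toℕ j) bits                      ≡⟨ bitAt-bits b j ⟩
    just (b j)                              ∎
    where
    open ≡-Reasoning
    bits = map bit (toList b)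

module QueryMachine where

  open QueryLanguage
  open TurnCounting
  open import Data.Nat as ℕ using (zero; suc; _≤_; _≥_; z≤n; s≤s)
  import Data.Nat.Properties as ℕ
  open import Data.Bool using (Bool; true; false)
  open import Data.Fin using (Fin; zero; suc)
  open import Data.List using (List; []; _∷_; _++_; map; length)
  open import Data.List.Relation.Unary.Linked using (Linked; [-]; _∷_)
  open import Data.Maybe as Maybe using (Maybe; just; nothing)
  open import Data.Product using (proj₁)
  open import Relation.Nullary using (contradiction)
  open import Relation.Binary.PropositionalEquality

  pattern start  = zero
  pattern count  = suc zero
  pattern drain  = suc (suc zero)
  pattern accept = suc (suc (suc zero))
  pattern reject = suc (suc (suc (suc zero)))

  pattern bottom = zero
  pattern mark   = suc zero

  data Action : Set where
    keep push pop : Action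

  perform : Action → Fin 2 → List (Fin 2)
  perform keep a = a ∷ []
  perform push a = mark ∷ a ∷ []
  perform pop  _ = []

  data Phase : Set where
    starting counting draining : Phase

  phase : Fin 5 → Phase
  phase start = starting
  phase count = counting
  phase _     = draining

  -- Each transition carries the certificate of how it changes phase and stack height; the height
  -- profile of a run, and with it the number of turns, is read off these certificates.
  data Legal : Phase → Phase → Action → Set where
    enter : Legal starting counting keep
    climb : Legal counting counting push
    hold  : ∀ {φ} → Legal φ draining keep
    drop  : ∀ {φ} → Legal φ draining pop

  record Move (q : Fin 5) : Set where
    constructor go
    field
      target : Fin 5
      action : Action
      legal  : Legal (phase q) (phase target) action

  readBit : ∀ {q} → Bool → Fin 2 → Move q
  readBit false bottom = go reject keep hold
  readBit true  bottom = go accept keep hold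
  readBit _     mark   = go drain pop drop

  move : (q : Fin 5) → Sym 3 → Fin 2 → Maybe (Move q)
  move start  ⊳                     _ = just (go count keep enter)
  move count  (letter two)          _ = just (go count push climb)
  move count  (letter zero)         a = just (readBit false a)
  move count  (letter (suc zero))   a = just (readBit true a)
  move drain  (letter zero)         a = just (readBit false a)
  move drain  (letter (suc zero))   a = just (readBit true a)
  move accept _                     _ = nothing
  move reject _                     _ = nothing
  move _      _                     _ = just (go reject keep hold)

  transition : ∀ {q} → Fin 2 → Move q → Fin 5 × List (Fin 2)
  transition a (go p act _) = p , perform act a

  δ : Fin 5 → Maybe (Sym 3) → Fin 2 → Maybe (Fin 5 × List (Fin 2))
  δ q (just σ) a = Maybe.map (transition a) (move q σ a)
  δ q nothing  a = nothing

  δ-move : ∀ q σ a {p w} → δ q (just σ) a ≡ just (p , w) → Σ (Move q) λ m → transition a m ≡ (p , w)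
  δ-move q σ a eq with move q σ a | eq
  ... | just m | refl = m , refl

  isAccept isReject : Fin 5 → Bool
  isAccept accept = true
  isAccept _      = false
  isReject reject = true
  isReject _      = false

  machine : DPDA 3
  machine = record
    { nQ = 5 ; nΓ = 2 ; e = 2 ; δ = δ ; q₀ = start ; bot = bottom ; acc = isAccept ; rej = isReject
    ; disjoint      = λ { accept _ → refl }
    ; pushBound     = push≤2
    ; deterministic = λ _ _ _ λ-move → contradiction refl λ-move }
    where
    push≤2 : ∀ q i a p w → δ q i a ≡ just (p , w) → length w ≤ 2
    push≤2 q (just σ) a p w eq with δ-move q σ a eq
    ... | go _ keep _ , refl = s≤s z≤n
    ... | go _ push _ , refl = s≤s (s≤s z≤n)
    ... | go _ pop  _ , refl = z≤n

  open DPDA machine using (Step; Steps; read; λ-step; done; next; height; init)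
  open Reachability machine

  Profile : Phase → List ℕ → Set
  Profile starting hs = turns hs ≤ 1
  Profile counting hs = Unimodal hs
  Profile draining hs = Linked _≥_ hs

  antitone-profile : ∀ φ {hs} → Linked _≥_ hs → Profile φ hs
  antitone-profile starting down = turns-unimodal (descending down)
  antitone-profile counting down = descending down
  antitone-profile draining down = down

  legal-profile : ∀ {φ ψ act} a st r → Legal φ ψ act →
    Profile ψ (length (perform act a ++ st) ∷ r) →
    Profile φ (suc (length st) ∷ length (perform act a ++ st) ∷ r)
  legal-profile a st r enter      p = subst (_≤ 1) (sym (turns-≥ r ℕ.≤-refl)) (turns-unimodal p)
  legal-profile a st r climb      p = ascending (ℕ.n<1+n _) p
  legal-profile a st r (hold {φ}) p = antitone-profile φ (ℕ.≤-refl ∷ p)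
  legal-profile a st r (drop {φ}) p = antitone-profile φ (ℕ.n≤1+n _ ∷ p)

  step-profile : ∀ {c c′ r} → Step c c′ →
    Profile (phase (proj₁ c′)) (height c′ ∷ r) →
    Profile (phase (proj₁ c)) (height c ∷ height c′ ∷ r)
  step-profile (λ-step _ ())
  step-profile (read {q} {σ} {_} {a} {st} _ eq) with δ-move q σ a eq
  ... | go _ _ legal , refl = legal-profile a st _ legal

  profile : ∀ {c c′ hs} → Steps c c′ hs → Profile (phase (proj₁ c)) hs
  profile {c} done                = antitone-profile (phase (proj₁ c)) [-]
  profile (next s done)           = step-profile s (antitone-profile _ [-])
  profile (next s rest@(next _ _)) = step-profile s (profile rest)

  one-turn : OneTurn machine
  one-turn _ _ _ = profile

  stack : ℕ → List (Fin 2)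
  stack zero    = bottom ∷ []
  stack (suc i) = mark ∷ stack i

  rest : List (Fin 3) → List (Sym 3)
  rest x = map letter x ++ ⊲ ∷ []

  answer : Bool → Fin 5
  answer false = reject
  answer true  = accept

  drain-run : ∀ i x {b} → bitAt i x ≡ just b → Reaches (drain , rest x , stack i) (answer b)
  drain-run i       []              ()
  drain-run i       (two ∷ x)       ()
  drain-run zero    (zero ∷ x)      refl = read refl refl ◅ here
  drain-run zero    (suc zero ∷ x)  refl = read refl refl ◅ here
  drain-run (suc i) (zero ∷ x)      eq   = read refl refl ◅ drain-run i x eq
  drain-run (suc i) (suc zero ∷ x)  eq   = read refl refl ◅ drain-run i x eq

  push-step : ∀ i inp → Step (count , letter two ∷ inp , stack i) (count , inp , stack (suc i))
  push-step zero    _ = read refl refl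
  push-step (suc _) _ = read refl refl

  count-run : ∀ i x {b} → query i x ≡ just b → Reaches (count , rest x , stack i) (answer b)
  count-run i       []              ()
  count-run i       (two ∷ x)       eq   = push-step i (rest x) ◅ count-run (suc i) x eq
  count-run zero    (zero ∷ x)      refl = read refl refl ◅ here
  count-run zero    (suc zero ∷ x)  refl = read refl refl ◅ here
  count-run (suc i) (zero ∷ x)      eq   = read refl refl ◅ drain-run i x eq
  count-run (suc i) (suc zero ∷ x)  eq   = read refl refl ◅ drain-run i x eq

  run : ∀ x {b} → query 0 x ≡ just b → Reaches (init x) (answer b)
  run x eq = read refl refl ◅ count-run 0 x eq

  query-in-1t1DPD : In1t1DPD Query
  query-in-1t1DPD =
    (λ _ → machine) ,
    (35 , 0 , λ _ → ℕ.m≤m+n 35 35) ,   -- size = |Q| · |Γ^{≤2}| = 5 · 7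
    (λ _ → one-turn) ,
    (λ _ x eq → accepts (run x eq) refl) , (λ _ x eq → rejects (run x eq) refl)

module LowerBound where

  open IntegerVectors
  open GapFactorisation
  open QueryLanguage
  import Data.Nat.Properties as ℕ
  open import Data.Bool using (Bool; true; false)
  open import Data.Fin using (Fin; toℕ)
  open import Data.List using (List; []; _∷_; _++_; map; replicate)
  import Data.List.Properties as List
  open import Data.Maybe using (just)
  open import Data.Integer using (0ℤ; _<_; _≤_)
  open import Data.Vec.Functional using (toList)
  open import Data.Sum using (inj₁; inj₂)
  open import Relation.Binary.PropositionalEquality

  separating-gap : ∀ {k} {L : PromiseFamily k} → In1P L → Σ (ℕ → NFA k) λ M →
    (∀ n x → PromiseFamily.L⁺ L n x → 0ℤ < NFA.gap (M n) x) ×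
    (∀ n x → PromiseFamily.L⁻ L n x → NFA.gap (M n) x ≤ 0ℤ)
  separating-gap (f , D , (M , _ , f≡gap) , covered , f>0 , f≤0) =
    M , (λ n x x∈L⁺ → subst (0ℤ <_) (f≡gap n x (covered n x (inj₁ x∈L⁺))) (f>0 n x x∈L⁺))
      , (λ n x x∈L⁻ → subst (_≤ 0ℤ) (f≡gap n x (covered n x (inj₂ x∈L⁻))) (f≤0 n x x∈L⁻))

  countingPrefix : ℕ → List (Sym 3)
  countingPrefix i = ⊳ ∷ map letter (replicate i two)

  bitSuffix : ∀ {m} → (Fin m → Bool) → List (Sym 3)
  bitSuffix b = map letter (map bit (toList b)) ++ ⊲ ∷ []

  tape-word : ∀ {m} (b : Fin m → Bool) i → tape (word b i) ≡ countingPrefix i ++ bitSuffix b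
  tape-word b i = cong (⊳ ∷_) (begin
    map letter (replicate i two ++ map bit (toList b)) ++ ⊲ ∷ []
      ≡⟨ cong (_++ ⊲ ∷ []) (List.map-++ letter (replicate i two) _) ⟩
    (map letter (replicate i two) ++ map letter (map bit (toList b))) ++ ⊲ ∷ []
      ≡⟨ List.++-assoc (map letter (replicate i two)) _ _ ⟩
    map letter (replicate i two) ++ bitSuffix b ∎)
    where open ≡-Reasoning

  no-nfa-decides-query : (N : NFA 3) → ¬ (∀ x b → query 0 x ≡ just b → Classifies b (NFA.gap N x))
  no-nfa-decides-query N decides =
    let b , unshattered = no-shattering (ℕ.n<1+n _) (λ j → prefixVector N (countingPrefix (toℕ j)))
    in unshattered (suffixVector N (bitSuffix b)) λ j →
         subst (Classifies (b j)) (gap-of-word b (toℕ j)) (decides (word b (toℕ j)) (b j) (query-word b j))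
    where
    gap-of-word : ∀ {m} (b : Fin m → Bool) i →
                  NFA.gap N (word b i) ≡ prefixVector N (countingPrefix i) · suffixVector N (bitSuffix b)
    gap-of-word b i = trans (cong (λ t → gapVector N t (NFA.q₀ N)) (tape-word b i))
                            (gap-bilinear N (countingPrefix i) (bitSuffix b))

  query-∉-1P : ¬ In1P Query
  query-∉-1P in1P =
    let M , accepted , rejected = separating-gap {L = Query} in1P
    in no-nfa-decides-query (M 0) λ { x true eq → accepted 0 x eq ; x false eq → rejected 0 x eq }

open QueryLanguage using (Query)
open QueryMachine using (query-in-1t1DPD)
open LowerBound using (query-∉-1P)

corollary5p2 : Σ ℕ λ k → Σ (PromiseFamily k) λ L → In1t1DPD L × ¬ In1P L
corollary5p2 = 3 , Query , query-in-1t1DPD , query-∉-1P
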